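{- Let $n \ge 2$, and assume there exists $\delta_n > 0$ such that every set $P$ of $n$ points in general position satisfies $\hat{d}_2(P) \ge \delta_n n$. Then $\mathsf{rc}(n) \le \frac{2}{\delta_n}\,\mathsf{rc}(n-1)$.
   Context: A finite point set in the plane is in general position if no two of its points share the same $x$-coordinate or the same $y$-coordinate. Let $B$ be an axis-parallel rectangle and $P$ a set of points in general position in the interior of $B$. A rectangulation of $(B,P)$ is a partition of $B$ into rectangles by axis-parallel segments such that every segment contains exactly one point of $P$, each point of $P$ lies on exactly one segment, and segments do not intersect in their interiors (an endpoint of one segment may lie in the interior of another segment or on the boundary of $B$). Let $R(P)$ be the set of rectangulations of $(B,P)$, $\mathsf{rc}(P)=|R(P)|$, and $\mathsf{rc}(m)$ the maximum of $\mathsf{rc}(P)$ over all sets $P$ of $m$ points in general position. In a rectangulation, an intersection is an endpoint of one segment that lies in the interior of another segment or on the boundary of $B$. The degree of a segment is the number of intersections lying on it (including its own two endpoints, so every degree is at least $2$). For $j \ge 2$ and a rectangulation $G$, $d_j(G)$ is the number of segments of degree $j$ in $G$, and $\hat{d}_j(P) = \frac{1}{\mathsf{rc}(P)}\sum_{G \in R(P)} d_j(G)$ is its average over all rectangulations of $P$.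
   Formalization: The rectangle $B$ and all point sets have rational coordinates, and the constant $\delta_n$ is rational. -}

module Defs where

open import Data.Nat as ℕ using (ℕ; zero; suc)
open import Data.Integer using (+_)
open import Data.Fin using (Fin; zero; suc)
open import Data.Fin.Properties using (all?) renaming (_≟_ to _≟ᶠ_)
open import Data.Maybe using (Maybe; just; nothing)
open import Data.Product using (_×_; _,_)
open import Data.Unit using (⊤; tt)
open import Data.List using (List; []; _∷_; map; concatMap; filter; length; allFin)
open import Data.Nat.ListAction using (sum)
open import Data.Vec.Functional using (Vector) renaming (_∷_ to _◂_)
open import Data.Rational using (ℚ; _<_; _≤_; 0ℚ; _/_)
open import Data.Rational.Properties using (_<?_; _≤?_; _≟_)
open import Relation.Nullary using (Dec; yes; no; ¬_; ¬?; _×-dec_; _→-dec_)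
open import Relation.Binary.PropositionalEquality using (_≡_; _≢_)

toℚ : ℕ → ℚ
toℚ m = + m / 1

-- A configuration (B , P): an axis-parallel rectangle
-- B = [xmin,xmax] × [ymin,ymax] and n points P = {(px i , py i)}
-- in general position (pairwise distinct x- and y-coordinates, which
-- also makes the n points pairwise distinct, so P has exactly n
-- elements) lying in the interior of B.

record Config (n : ℕ) : Set where
  field
    xmin xmax ymin ymax : ℚ
    xmin<xmax : xmin < xmax
    ymin<ymax : ymin < ymax
    px py : Fin n → ℚ
    px-inj : ∀ i j → px i ≡ px j → i ≡ j
    py-inj : ∀ i j → py i ≡ py j → i ≡ j
    inside : ∀ i → (xmin < px i × px i < xmax) × (ymin < py i × py i < ymax)

-- Every segment contains exactly one point of P, so segments are indexed
-- by the points.  Segment i is horizontal or vertical through point i.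
-- Its lower (resp. upper) endpoint -- lower/upper in y for a vertical
-- segment, left/right in x for a horizontal one -- is either on the
-- boundary of B (nothing) or on the segment of some point j (just j);
-- in the latter case the coordinate of the endpoint along segment i is
-- the corresponding coordinate of point j.

data Orient : Set where
  hor ver : Orient

data Side : Set where
  low high : Side

SegData : ℕ → Set
SegData n = Orient × Maybe (Fin n) × Maybe (Fin n)

Encoding : ℕ → Set
Encoding n = Fin n → SegData n

Pt : Set
Pt = ℚ × ℚ

module Geometry {n : ℕ} (C : Config n) (E : Encoding n) where
  open Config C

  orient : Fin n → Orient
  orient i with E i
  ... | (o , _ , _) = o

  stopper : Fin n → Side → Maybe (Fin n)
  stopper i low  with E i
  ... | (_ , l , _) = l
  stopper i high with E i
  ... | (_ , _ , h) = h

  along : Orient → Fin n → ℚ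
  along ver j = py j
  along hor j = px j

  bound : Orient → Side → ℚ
  bound ver low  = ymin
  bound ver high = ymax
  bound hor low  = xmin
  bound hor high = xmax

  endC : Fin n → Side → ℚ
  endC i s with stopper i s
  ... | nothing = bound (orient i) s
  ... | just j  = along (orient i) j

  endpoint : Fin n → Side → Pt
  endpoint i s with orient i
  ... | ver = (px i , endC i s)
  ... | hor = (endC i s , py i)

  OnSeg : Fin n → Pt → Set
  OnSeg i (x , y) with orient i
  ... | ver = x ≡ px i × (endC i low ≤ y × y ≤ endC i high)
  ... | hor = y ≡ py i × (endC i low ≤ x × x ≤ endC i high)

  onSeg? : ∀ i q → Dec (OnSeg i q)
  onSeg? i (x , y) with orient i
  ... | ver = (x ≟ px i) ×-dec ((endC i low ≤? y) ×-dec (y ≤? endC i high))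
  ... | hor = (y ≟ py i) ×-dec ((endC i low ≤? x) ×-dec (x ≤? endC i high))

  OnInt : Fin n → Pt → Set
  OnInt i (x , y) with orient i
  ... | ver = x ≡ px i × (endC i low < y × y < endC i high)
  ... | hor = y ≡ py i × (endC i low < x × x < endC i high)

  onInt? : ∀ i q → Dec (OnInt i q)
  onInt? i (x , y) with orient i
  ... | ver = (x ≟ px i) ×-dec ((endC i low <? y) ×-dec (y <? endC i high))
  ... | hor = (y ≟ py i) ×-dec ((endC i low <? x) ×-dec (x <? endC i high))

  ContainsPt : Fin n → Set
  ContainsPt i = endC i low < along (orient i) i × along (orient i) i < endC i high

  containsPt? : ∀ i → Dec (ContainsPt i)
  containsPt? i = (endC i low <? along (orient i) i) ×-dec (along (orient i) i <? endC i high)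

  Supported : Fin n → Side → Set
  Supported i s with stopper i s
  ... | nothing = ⊤
  ... | just j  = j ≢ i × OnInt j (endpoint i s)

  supported? : ∀ i s → Dec (Supported i s)
  supported? i s with stopper i s
  ... | nothing = yes tt
  ... | just j  = ¬? (j ≟ᶠ i) ×-dec onInt? j (endpoint i s)

  -- (V3) distinct segments do not meet in their interiors.  The only
  -- possible common point of two axis-parallel segments through
  -- points in general position is the intersection of their lines:
  crossPt : Fin n → Fin n → Pt
  crossPt i j with orient i
  ... | ver = (px i , py j)
  ... | hor = (px j , py i)

  NoCross : Fin n → Fin n → Set
  NoCross i j = ¬ (OnInt i (crossPt i j) × OnInt j (crossPt i j))

  noCross? : ∀ i j → Dec (NoCross i j)
  noCross? i j = ¬? (onInt? i (crossPt i j) ×-dec onInt? j (crossPt i j))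

  Valid : Set
  Valid = (∀ i → ContainsPt i)
        × ((∀ i → Supported i low) × (∀ i → Supported i high))
        × (∀ i j → i ≢ j → NoCross i j)

  valid? : Dec Valid
  valid? = all? containsPt?
      ×-dec ((all? (λ i → supported? i low) ×-dec all? (λ i → supported? i high))
      ×-dec all? (λ i → all? (λ j → ¬? (i ≟ᶠ j) →-dec noCross? i j)))

  -- intersections lying on segment i: endpoints (of all segments,
  -- including i itself) that lie on segment i.  In a valid encoding
  -- every endpoint is an intersection and distinct endpoints are
  -- distinct points.
  endpoints : List (Fin n × Side)
  endpoints = concatMap (λ j → (j , low) ∷ (j , high) ∷ []) (allFin n)

  degree : Fin n → ℕ
  degree i = length (filter (λ { (j , s) → onSeg? i (endpoint j s) }) endpoints)

  dcount : ℕ → ℕ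
  dcount k = length (filter (λ i → degree i ℕ.≟ k) (allFin n))

allFuns : {A : Set} → List A → (n : ℕ) → List (Vector A n)
allFuns xs zero    = (λ ()) ∷ []
allFuns xs (suc n) = concatMap (λ a → map (a ◂_) (allFuns xs n)) xs

allSegData : (n : ℕ) → List (SegData n)
allSegData n =
  concatMap (λ o → concatMap (λ l → map (λ h → (o , l , h)) stops) stops) (hor ∷ ver ∷ [])
  where
  stops : List (Maybe (Fin n))
  stops = nothing ∷ map just (allFin n)

allEncodings : (n : ℕ) → List (Encoding n)
allEncodings n = allFuns (allSegData n) n

rects : {n : ℕ} → Config n → List (Encoding n)
rects {n} C = filter (λ E → Geometry.valid? C E) (allEncodings n)

rc : {n : ℕ} → Config n → ℕ
rc C = length (rects C)

-- average of a list of naturals (0 for the empty list)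
average : List ℕ → ℚ
average xs with length xs
... | zero  = 0ℚ
... | suc k = + sum xs / suc k

dhat : {n : ℕ} → ℕ → Config n → ℚ
dhat k C = average (map (λ E → Geometry.dcount C E k) (rects C))

{-# OPTIONS --safe #-}
module Submission where

-- Count the pairs (G , i) with segment i of degree 2 in the rectangulation G in two ways.
-- Per rectangulation there are d₂(G) of them, so their number is at least δ·n·rc(P).  Per point i:
-- if segment i has degree 2, no other segment ends on it, so deleting point i and its segment
-- leaves a rectangulation of the other n - 1 points; and G is recovered from that rectangulation
-- together with the orientation of segment i, because in G segment i must run exactly until it
-- meets the first perpendicular segment (or the boundary) on each side.  Hence every point has
-- degree 2 in at most 2·rc(n - 1) rectangulations, and δ·n·rc(P) ≤ 2·n·rc(n - 1).

open import Defs
open import Data.Nat as ℕ using (ℕ; zero; suc; _≤_; _∸_; z≤n; s≤s)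
import Data.Nat.Properties as ℕ
open import Data.Integer as ℤ using (+_)
import Data.Integer.Properties as ℤ
open import Data.Fin using (Fin; zero; suc; punchIn; punchOut)
open import Data.Fin.Properties using (punchIn-injective; punchIn-punchOut) renaming (_≟_ to _≟ᶠ_)
open import Data.Maybe as Maybe using (Maybe; just; nothing)
import Data.Maybe.Properties as Maybe
open import Data.Product using (_×_; _,_; proj₁; proj₂)
open import Data.Product.Relation.Binary.Pointwise.NonDependent using (_×ₛ_)
open import Data.Unit using (⊤; tt)
open import Data.Empty using (⊥-elim)
open import Data.List using (List; []; _∷_; map; concatMap; filter; length; allFin; cartesianProduct)
open import Data.List.Properties using (length-removeAt′; length-++; length-map; length-tabulate)
open import Data.Nat.ListAction using (sum)
open import Data.List.Relation.Unary.All as All using (All; []; _∷_)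
import Data.List.Relation.Unary.All.Properties as All
open import Data.List.Relation.Unary.Any as Any using (Any; here; there; index)
import Data.List.Relation.Unary.Any.Properties as Any
import Data.List.Relation.Unary.AllPairs as AllPairs
import Data.List.Relation.Unary.AllPairs.Properties as AllPairs
open import Data.List.Relation.Unary.AllPairs using ([]; _∷_)
open import Data.List.Relation.Unary.Unique.Setoid using (Unique)
import Data.List.Relation.Unary.Unique.Setoid.Properties as Unique
open import Data.List.Relation.Unary.Unique.Propositional.Properties using (allFin⁺)
open import Data.List.Relation.Binary.Disjoint.Setoid using (Disjoint)
import Data.List.Membership.Setoid as Membership
import Data.List.Membership.Setoid.Properties as Membershipₚ
open import Data.List.Membership.Propositional using (_∈_)
open import Data.List.Membership.Propositional.Properties using (∈-allFin; ∈-map⁺; ∈-filter⁺; ∈-filter⁻)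
open import Data.Vec.Functional using (Vector) renaming (_∷_ to _◂_)
open import Data.Rational using (ℚ; Positive; _<_; _*_; _÷_; _/_; 1/_; toℚᵘ) renaming (_≤_ to _≤ℚ_)
open import Data.Rational.Properties as ℚ
  using (<⇒≤; ≤-refl; <-trans; ≤-antisym; ≮⇒≥;
         pos⇒nonZero; pos⇒nonNeg; 1/pos⇒pos; normalize-pos; normalize-nonNeg;
         toℚᵘ-injective; toℚᵘ-cancel-≤; toℚᵘ-fromℚᵘ; toℚᵘ-homo-*;
         *-comm; *-assoc; *-identityˡ; *-inverseˡ; *-monoʳ-≤-nonNeg; *-monoˡ-≤-nonNeg; *-cancelˡ-≤-pos)
import Data.Rational.Unnormalised as ℚᵘ
import Data.Rational.Unnormalised.Properties as ℚᵘ
open import Relation.Nullary using (Dec; yes; no; ¬_; contradiction)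
open import Relation.Binary using (Setoid)
open import Relation.Binary.PropositionalEquality
open import Function using (id; _∘_; _∘′_)

-- Counting in lists

module _ {b ℓ} (T : Setoid b ℓ) where
  open Setoid T using (Carrier; _≈_) renaming (sym to ≈-sym; trans to ≈-trans)
  open Membership T using (_─_) renaming (_∈_ to _∈ₛ_)

  ∈-─⁺ : ∀ {x y ys} (x∈ys : x ∈ₛ ys) → y ∈ₛ ys → ¬ x ≈ y → y ∈ₛ ys ─ x∈ys
  ∈-─⁺ (here x≈z)   (here y≈z)   x≉y = ⊥-elim (x≉y (≈-trans x≈z (≈-sym y≈z)))
  ∈-─⁺ (here _)     (there y∈ys) _   = y∈ys
  ∈-─⁺ (there _)    (here y≈z)   _   = here y≈z
  ∈-─⁺ (there x∈ys) (there y∈ys) x≉y = there (∈-─⁺ x∈ys y∈ys x≉y)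

  injective⇒length-≤ : ∀ {a ℓ′} (S : Setoid a ℓ′) (f : Setoid.Carrier S → Carrier) {xs ys} → Unique S xs →
    (∀ {x y} → x ∈ xs → y ∈ xs → f x ≈ f y → Setoid._≈_ S x y) →
    (∀ {x} → x ∈ xs → f x ∈ₛ ys) →
    length xs ≤ length ys
  injective⇒length-≤ S f {[]}     _            _   _    = z≤n
  injective⇒length-≤ S f {x ∷ xs} {ys} (x∉xs ∷ xs!) inj into = begin
    suc (length xs)           ≤⟨ s≤s (injective⇒length-≤ S f xs! (λ p q → inj (there p) (there q)) into′) ⟩
    suc (length (ys ─ fx∈ys)) ≡⟨ length-removeAt′ ys (index fx∈ys) ⟨
    length ys                 ∎
    where
    open ℕ.≤-Reasoning
    fx∈ys = into (here refl)
    into′ : ∀ {y} → y ∈ xs → f y ∈ₛ ys ─ fx∈ys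
    into′ y∈xs = ∈-─⁺ fx∈ys (into (there y∈xs))
      (λ fx≈fy → All.lookup x∉xs y∈xs (inj (here refl) (there y∈xs) fx≈fy))

module _ {A I : Set} {R : A → I → Set} (R? : ∀ a i → Dec (R a i)) where
  open import Algebra.Properties.CommutativeSemigroup ℕ.+-commutativeSemigroup using (x∙yz≈y∙xz)

  double-counting : ∀ as is →
    sum (map (λ a → length (filter (R? a) is)) as) ≡ sum (map (λ i → length (filter (λ a → R? a i) as)) is)
  double-counting []       is = sym (sum-zeros is)
    where
    sum-zeros : ∀ is → sum (map (λ _ → 0) is) ≡ 0
    sum-zeros []       = refl
    sum-zeros (_ ∷ is) = sum-zeros is
  double-counting (a ∷ as) is = begin
    length (filter (R? a) is) ℕ.+ sum (map (λ b → length (filter (R? b) is)) as)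
      ≡⟨ cong (length (filter (R? a) is) ℕ.+_) (double-counting as is) ⟩
    length (filter (R? a) is) ℕ.+ sum (map column is)
      ≡⟨ add-row is ⟨
    sum (map (λ i → length (filter (λ b → R? b i) (a ∷ as))) is) ∎
    where
    open ≡-Reasoning
    column : I → ℕ
    column i = length (filter (λ b → R? b i) as)
    add-row : ∀ js → sum (map (λ i → length (filter (λ b → R? b i) (a ∷ as))) js)
                   ≡ length (filter (R? a) js) ℕ.+ sum (map column js)
    shift : ∀ i js → column i ℕ.+ sum (map (λ i → length (filter (λ b → R? b i) (a ∷ as))) js)
                   ≡ length (filter (R? a) js) ℕ.+ (column i ℕ.+ sum (map column js))
    add-row []       = refl
    add-row (i ∷ js) with R? a i
    ... | yes _ = cong suc (shift i js)
    ... | no  _ = shift i js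
    shift i js = trans (cong (column i ℕ.+_) (add-row js))
                       (x∙yz≈y∙xz (column i) (length (filter (R? a) js)) (sum (map column js)))

sum-map-≤ : ∀ {I : Set} (f : I → ℕ) {B} is → (∀ i → f i ≤ B) → sum (map f is) ≤ length is ℕ.* B
sum-map-≤ f []       _   = z≤n
sum-map-≤ f (i ∷ is) f≤B = ℕ.+-mono-≤ (f≤B i) (sum-map-≤ f is f≤B)

length-cartesianProduct : ∀ {A B : Set} (xs : List A) (ys : List B) →
  length (cartesianProduct xs ys) ≡ length xs ℕ.* length ys
length-cartesianProduct []       ys = refl
length-cartesianProduct (x ∷ xs) ys =
  trans (length-++ (map (x ,_) ys)) (cong₂ ℕ._+_ (length-map (x ,_) ys) (length-cartesianProduct xs ys))

-- Enumerating encodings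

module _ {c ℓ} (S : Setoid c ℓ) where
  open Setoid S using (Carrier; _≈_) renaming (sym to ≈-sym)
  open Membership S using () renaming (_∈_ to _∈ₛ_)

  concatMap-unique-by-key : ∀ {A : Set} (key : Carrier → A) → (∀ {x y} → x ≈ y → key x ≡ key y) →
    (F : A → List Carrier) → (∀ a → Unique S (F a)) → (∀ a → All (λ x → key x ≡ a) (F a)) →
    ∀ {as} → Unique (setoid A) as → Unique S (concatMap F as)
  concatMap-unique-by-key key key-resp F F! F-key as! =
    Unique.concat⁺ S (All.map⁺ (All.universal F! _)) (AllPairs.map⁺ (AllPairs.map disjoint as!))
    where
    key-∈ : ∀ {a x} → x ∈ₛ F a → key x ≡ a
    key-∈ {a} = All.lookupₛ S (λ x≈y kx≡a → trans (key-resp (≈-sym x≈y)) kx≡a) (F-key a)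
    disjoint : ∀ {a b} → a ≢ b → Disjoint S (F a) (F b)
    disjoint a≢b (x∈Fa , x∈Fb) = a≢b (trans (sym (key-∈ x∈Fa)) (key-∈ x∈Fb))

  ∈-concatMap⁺′ : ∀ {A : Set} (F : A → List Carrier) {a as x} →
    a ∈ as → x ∈ₛ F a → x ∈ₛ concatMap F as
  ∈-concatMap⁺′ F a∈as x∈Fa = Any.concatMap⁺ F (Any.map (λ { refl → x∈Fa }) a∈as)

module _ {A : Set} (xs : List A) where

  allFuns-unique : Unique (setoid A) xs → ∀ n → Unique (Fin n →-setoid A) (allFuns xs n)
  allFuns-unique xs! zero    = [] ∷ []
  allFuns-unique xs! (suc n) =
    concatMap-unique-by-key (Fin (suc n) →-setoid A) (λ f → f zero) (λ f≈g → f≈g zero)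
      (λ a → map (a ◂_) (allFuns xs n))
      (λ a → Unique.map⁺ (Fin n →-setoid A) (Fin (suc n) →-setoid A) (λ e i → e (suc i)) (allFuns-unique xs! n))
      (λ a → All.map⁺ (All.universal (λ _ → refl) (allFuns xs n)))
      xs!

  ∈-allFuns : ∀ n (f : Vector A n) → (∀ i → f i ∈ xs) → Membership._∈_ (Fin n →-setoid A) f (allFuns xs n)
  ∈-allFuns zero    f _    = here (λ ())
  ∈-allFuns (suc n) f f∈xs =
    ∈-concatMap⁺′ (Fin (suc n) →-setoid A) (λ a → map (a ◂_) (allFuns xs n)) (f∈xs zero)
      (Any.map⁺ (Any.map (λ tail≈ → λ { zero → refl ; (suc i) → tail≈ i })
                         (∈-allFuns n (f ∘ suc) (f∈xs ∘ suc))))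

allStops : ∀ n → List (Maybe (Fin n))
allStops n = nothing ∷ map just (allFin n)

allStops-unique : ∀ n → Unique (setoid _) (allStops n)
allStops-unique n =
  All.map⁺ (All.universal (λ _ ()) _) ∷ Unique.map⁺ (setoid _) (setoid _) (λ { refl → refl }) (allFin⁺ n)

∈-allStops : ∀ {n} (k? : Maybe (Fin n)) → k? ∈ allStops n
∈-allStops nothing  = here refl
∈-allStops (just k) = there (∈-map⁺ just (∈-allFin k))

allSegData-unique : ∀ n → Unique (setoid (SegData n)) (allSegData n)
allSegData-unique n = concatMap-unique-by-key S proj₁ (cong proj₁) withOrient
  (λ o → concatMap-unique-by-key S (proj₁ ∘ proj₂) (cong (proj₁ ∘ proj₂)) (withStops o)
     (λ l → Unique.map⁺ (setoid _) S (λ { refl → refl }) (allStops-unique n))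
     (λ l → All.map⁺ (All.universal (λ _ → refl) (allStops n)))
     (allStops-unique n))
  (λ o → All.concat⁺ (All.map⁺ (All.universal (λ l → All.map⁺ (All.universal (λ _ → refl) (allStops n)))
                                               (allStops n))))
  (((λ ()) ∷ []) ∷ [] ∷ [])
  where
  S = setoid (SegData n)
  withStops : Orient → Maybe (Fin n) → List (SegData n)
  withStops o l = map (λ h → (o , l , h)) (allStops n)
  withOrient : Orient → List (SegData n)
  withOrient o = concatMap (withStops o) (allStops n)

∈-orientations : ∀ o → o ∈ hor ∷ ver ∷ []
∈-orientations hor = here refl
∈-orientations ver = there (here refl)

∈-allSegData : ∀ {n} (d : SegData n) → d ∈ allSegData n
∈-allSegData {n} (o , l , h) =
  ∈-concatMap⁺′ S (λ o → concatMap (withStops o) (allStops n)) (∈-orientations o)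
    (∈-concatMap⁺′ S (withStops o) (∈-allStops l) (∈-map⁺ (λ h → (o , l , h)) (∈-allStops h)))
  where
  S = setoid (SegData n)
  withStops : Orient → Maybe (Fin n) → List (SegData n)
  withStops o l = map (λ h → (o , l , h)) (allStops n)

encodingSetoid : ℕ → Setoid _ _
encodingSetoid n = Fin n →-setoid SegData n

rects-unique : ∀ {n} (C : Config n) → Unique (encodingSetoid n) (rects C)
rects-unique {n} C =
  Unique.filter⁺ (encodingSetoid n) (Geometry.valid? C) (allFuns-unique (allSegData n) (allSegData-unique n) n)

-- Segments

coord : Orient → Pt → ℚ
coord ver (_ , y) = y
coord hor (x , _) = x

withCoord : Orient → Pt → ℚ → Pt
withCoord ver (x , _) c = (x , c)
withCoord hor (_ , y) c = (c , y)

record Segment : Set where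
  constructor segment
  field
    orientation : Orient
    base        : Pt
    lo hi       : ℚ

open Segment

Interior : Segment → Pt → Set
Interior (segment ver (x₀ , _) lo hi) (x , y) = x ≡ x₀ × (lo < y × y < hi)
Interior (segment hor (_ , y₀) lo hi) (x , y) = y ≡ y₀ × (lo < x × x < hi)

Spans : Segment → Set
Spans σ = lo σ < coord (orientation σ) (base σ) × coord (orientation σ) (base σ) < hi σ

endCoord : Segment → Side → ℚ
endCoord σ low  = lo σ
endCoord σ high = hi σ

endOf : Segment → Side → Pt
endOf σ s = withCoord (orientation σ) (base σ) (endCoord σ s)

meet : Segment → Pt → Pt
meet σ q = withCoord (orientation σ) (base σ) (coord (orientation σ) q)

interior-meet : ∀ σ q → lo σ < coord (orientation σ) q → coord (orientation σ) q < hi σ → Interior σ (meet σ q)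
interior-meet (segment ver _ _ _) q l h = refl , l , h
interior-meet (segment hor _ _ _) q l h = refl , l , h

Beyond : Side → ℚ → ℚ → Set
Beyond low  a b = a < b
Beyond high a b = b < a

¬Beyond⇒≡ : ∀ s {a b} → ¬ Beyond s a b → ¬ Beyond s b a → a ≡ b
¬Beyond⇒≡ low  a≮b b≮a = ≤-antisym (≮⇒≥ b≮a) (≮⇒≥ a≮b)
¬Beyond⇒≡ high b≮a a≮b = ≤-antisym (≮⇒≥ b≮a) (≮⇒≥ a≮b)

overhang⇒interior-meet : ∀ o b (ends ends′ : Side → ℚ) s q →
  Spans (segment o b (ends low) (ends high)) → Spans (segment o b (ends′ low) (ends′ high)) →
  ends′ s ≡ coord o q → Beyond s (ends s) (ends′ s) →
  Interior (segment o b (ends low) (ends high)) (meet (segment o b (ends low) (ends high)) q)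
overhang⇒interior-meet o b ends ends′ low  q (lo<b , b<hi) (lo′<b , b<hi′) stop lo<lo′ =
  interior-meet (segment o b _ _) q (subst (ends low <_) stop lo<lo′) (subst (_< ends high) stop (<-trans lo′<b b<hi))
overhang⇒interior-meet o b ends ends′ high q (lo<b , b<hi) (lo′<b , b<hi′) stop hi′<hi =
  interior-meet (segment o b _ _) q (subst (ends low <_) stop (<-trans lo<b b<hi′)) (subst (_< ends high) stop hi′<hi)

point : ∀ {n} → Config n → Fin n → Pt
point C k = (Config.px C k , Config.py C k)

boxBound : ∀ {n} → Config n → Orient → Side → ℚ
boxBound C ver low  = Config.ymin C
boxBound C ver high = Config.ymax C
boxBound C hor low  = Config.xmin C
boxBound C hor high = Config.xmax C

endAt : ∀ {n} → Config n → Orient → Side → Maybe (Fin n) → ℚ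
endAt C o s = Maybe.maybe (coord o ∘′ point C) (boxBound C o s)

stopOf : ∀ {n} → SegData n → Side → Maybe (Fin n)
stopOf (_ , l , _) low  = l
stopOf (_ , _ , h) high = h

segmentOf : ∀ {n} → Config n → Fin n → SegData n → Segment
segmentOf C i d =
  segment (proj₁ d) (point C i) (endAt C (proj₁ d) low (stopOf d low)) (endAt C (proj₁ d) high (stopOf d high))

module _ {n} (C : Config n) where
  open Config C

  boxBound-beyond : ∀ o s k → Beyond s (boxBound C o s) (coord o (point C k))
  boxBound-beyond ver low  k = proj₁ (proj₂ (inside k))
  boxBound-beyond ver high k = proj₂ (proj₂ (inside k))
  boxBound-beyond hor low  k = proj₁ (proj₁ (inside k))
  boxBound-beyond hor high k = proj₂ (proj₁ (inside k))

  coord-injective : ∀ o {k k′} → coord o (point C k) ≡ coord o (point C k′) → k ≡ k′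
  coord-injective ver = py-inj _ _
  coord-injective hor = px-inj _ _

-- Geometry defines its notions by `with` on the orientation and the stoppers, so they only
-- compute once those are known; here they are restated through the Segment of each point,
-- which depends on the encoding only through its value at that point.
module Views {n} (C : Config n) (E : Encoding n) where
  open Geometry C E

  segmentAt : Fin n → Segment
  segmentAt i = segment (orient i) (point C i) (endC i low) (endC i high)

  stopper≡ : ∀ i s → stopper i s ≡ stopOf (E i) s
  stopper≡ i low  = refl
  stopper≡ i high = refl

  endCoord≡ : ∀ i s → endCoord (segmentAt i) s ≡ endC i s
  endCoord≡ i low  = refl
  endCoord≡ i high = refl

  endC≡ : ∀ i s → endC i s ≡ endAt C (orient i) s (stopper i s)
  endC≡ i s with stopper i s
  ... | nothing = bound≡ (orient i) s
    where
    bound≡ : ∀ o s → bound o s ≡ boxBound C o s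
    bound≡ ver low  = refl
    bound≡ ver high = refl
    bound≡ hor low  = refl
    bound≡ hor high = refl
  ... | just k  = along≡ (orient i)
    where
    along≡ : ∀ o → along o k ≡ coord o (point C k)
    along≡ ver = refl
    along≡ hor = refl

  endC-unstopped : ∀ i s → stopper i s ≡ nothing → endC i s ≡ boxBound C (orient i) s
  endC-unstopped i s stops = trans (endC≡ i s) (cong (endAt C (orient i) s) stops)

  endC-stopped : ∀ i s {k} → stopper i s ≡ just k → endC i s ≡ coord (orient i) (point C k)
  endC-stopped i s stops = trans (endC≡ i s) (cong (endAt C (orient i) s) stops)

  segmentAt≡segmentOf : ∀ i → segmentAt i ≡ segmentOf C i (E i)
  segmentAt≡segmentOf i = cong₂ (segment (orient i) (point C i)) (endC≡ i low) (endC≡ i high)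

  OnInt≡ : ∀ i q → OnInt i q ≡ Interior (segmentAt i) q
  OnInt≡ i (x , y) with orient i
  ... | ver = refl
  ... | hor = refl

  endpoint≡ : ∀ i s → endpoint i s ≡ endOf (segmentAt i) s
  endpoint≡ i low  with orient i
  ... | ver = refl
  ... | hor = refl
  endpoint≡ i high with orient i
  ... | ver = refl
  ... | hor = refl

  crossPt≡ : ∀ i j → crossPt i j ≡ meet (segmentAt i) (point C j)
  crossPt≡ i j with orient i
  ... | ver = refl
  ... | hor = refl

  ContainsPt≡ : ∀ i → ContainsPt i ≡ Spans (segmentAt i)
  ContainsPt≡ i with orient i
  ... | ver = refl
  ... | hor = refl

  SupportedBy : Fin n → Maybe (Fin n) → Pt → Set
  SupportedBy i nothing  p = ⊤
  SupportedBy i (just j) p = j ≢ i × OnInt j p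

  Supported≡ : ∀ i s → Supported i s ≡ SupportedBy i (stopper i s) (endpoint i s)
  Supported≡ i s with stopper i s
  ... | nothing = refl
  ... | just _  = refl

  supported : Valid → ∀ i s → SupportedBy i (stopper i s) (endpoint i s)
  supported (_ , (supported-low , _) , _) i low  = subst id (Supported≡ i low) (supported-low i)
  supported (_ , (_ , supported-high) , _) i high = subst id (Supported≡ i high) (supported-high i)

module _ {n} (C : Config n) {E E′ : Encoding n} where

  segmentAt-local : ∀ k → E k ≡ E′ k → Views.segmentAt C E k ≡ Views.segmentAt C E′ k
  segmentAt-local k Ek≡E′k = trans (Views.segmentAt≡segmentOf C E k)
    (trans (cong (segmentOf C k) Ek≡E′k) (sym (Views.segmentAt≡segmentOf C E′ k)))

  OnInt-local : ∀ k q → E k ≡ E′ k → Geometry.OnInt C E k q ≡ Geometry.OnInt C E′ k q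
  OnInt-local k q Ek≡E′k = trans (Views.OnInt≡ C E k q)
    (trans (cong (λ σ → Interior σ q) (segmentAt-local k Ek≡E′k)) (sym (Views.OnInt≡ C E′ k q)))

-- Restriction along injective relabellings

relabel : ∀ {m n} → (Maybe (Fin m) → Maybe (Fin n)) → SegData m → SegData n
relabel f (o , l , h) = (o , f l , f h)

stopOf-relabel : ∀ {m n} (f : Maybe (Fin m) → Maybe (Fin n)) d s → stopOf (relabel f d) s ≡ f (stopOf d s)
stopOf-relabel f d low  = refl
stopOf-relabel f d high = refl

module Restriction {m n} (C′ : Config m) (C : Config n) (φ : Fin m → Fin n)
  (φ-injective : ∀ {j k} → φ j ≡ φ k → j ≡ k)
  (same-box : ∀ o s → boxBound C′ o s ≡ boxBound C o s)
  (same-points : ∀ k → point C′ k ≡ point C (φ k))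
  (E′ : Encoding m) (E : Encoding n)
  (restricts : ∀ j → E (φ j) ≡ relabel (Maybe.map φ) (E′ j)) where

  private
    module G′ = Geometry C′ E′
    module G  = Geometry C E
    module V′ = Views C′ E′
    module V  = Views C E

  endAt-map : ∀ o s k? → endAt C o s (Maybe.map φ k?) ≡ endAt C′ o s k?
  endAt-map o s nothing  = sym (same-box o s)
  endAt-map o s (just k) = cong (coord o) (sym (same-points k))

  segmentOf-relabel : ∀ j d → segmentOf C (φ j) (relabel (Maybe.map φ) d) ≡ segmentOf C′ j d
  segmentOf-relabel j (o , l , h) rewrite same-points j =
    cong₂ (segment o (point C (φ j))) (endAt-map o low l) (endAt-map o high h)

  segment≡ : ∀ j → V′.segmentAt j ≡ V.segmentAt (φ j)
  segment≡ j = begin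
    V′.segmentAt j                                    ≡⟨ V′.segmentAt≡segmentOf j ⟩
    segmentOf C′ j (E′ j)                             ≡⟨ segmentOf-relabel j (E′ j) ⟨
    segmentOf C (φ j) (relabel (Maybe.map φ) (E′ j))  ≡⟨ cong (segmentOf C (φ j)) (restricts j) ⟨
    segmentOf C (φ j) (E (φ j))                       ≡⟨ V.segmentAt≡segmentOf (φ j) ⟨
    V.segmentAt (φ j)                                 ∎
    where open ≡-Reasoning

  stopper≡ : ∀ j s → G.stopper (φ j) s ≡ Maybe.map φ (G′.stopper j s)
  stopper≡ j s = begin
    G.stopper (φ j) s                        ≡⟨ V.stopper≡ (φ j) s ⟩
    stopOf (E (φ j)) s                       ≡⟨ cong (λ d → stopOf d s) (restricts j) ⟩
    stopOf (relabel (Maybe.map φ) (E′ j)) s  ≡⟨ stopOf-relabel (Maybe.map φ) (E′ j) s ⟩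
    Maybe.map φ (stopOf (E′ j) s)            ≡⟨ cong (Maybe.map φ) (V′.stopper≡ j s) ⟨
    Maybe.map φ (G′.stopper j s)             ∎
    where open ≡-Reasoning

  OnInt≡ : ∀ k q → G′.OnInt k q ≡ G.OnInt (φ k) q
  OnInt≡ k q = trans (V′.OnInt≡ k q)
    (trans (cong (λ σ → Interior σ q) (segment≡ k)) (sym (V.OnInt≡ (φ k) q)))

  endpoint≡ : ∀ j s → G′.endpoint j s ≡ G.endpoint (φ j) s
  endpoint≡ j s = trans (V′.endpoint≡ j s)
    (trans (cong (λ σ → endOf σ s) (segment≡ j)) (sym (V.endpoint≡ (φ j) s)))

  crossPt≡ : ∀ j k → G′.crossPt j k ≡ G.crossPt (φ j) (φ k)
  crossPt≡ j k = trans (V′.crossPt≡ j k)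
    (trans (cong₂ meet (segment≡ j) (same-points k)) (sym (V.crossPt≡ (φ j) (φ k))))

  ContainsPt≡ : ∀ j → G′.ContainsPt j ≡ G.ContainsPt (φ j)
  ContainsPt≡ j = trans (V′.ContainsPt≡ j)
    (trans (cong Spans (segment≡ j)) (sym (V.ContainsPt≡ (φ j))))

  supported : G.Valid → ∀ j s → G′.Supported j s
  supported valid j s with G′.stopper j s in stops
  ... | nothing = tt
  ... | just k  = (φk≢φj ∘ cong φ) , subst id (sym (OnInt≡ k _)) (subst (G.OnInt (φ k)) (sym (endpoint≡ j s)) onInt)
    where
    stops-φ : G.stopper (φ j) s ≡ just (φ k)
    stops-φ = trans (stopper≡ j s) (cong (Maybe.map φ) stops)
    supported-φ : V.SupportedBy (φ j) (just (φ k)) (G.endpoint (φ j) s)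
    supported-φ = subst (λ k? → V.SupportedBy (φ j) k? (G.endpoint (φ j) s)) stops-φ (V.supported valid (φ j) s)
    φk≢φj = proj₁ supported-φ
    onInt = proj₂ supported-φ

  noCross : ∀ j k → G.NoCross (φ j) (φ k) → G′.NoCross j k
  noCross j k noCross-φ (onInt-j , onInt-k) = noCross-φ (transport onInt-j , transport onInt-k)
    where
    transport : ∀ {l} → G′.OnInt l (G′.crossPt j k) → G.OnInt (φ l) (G.crossPt (φ j) (φ k))
    transport {l} h = subst (G.OnInt (φ l)) (crossPt≡ j k) (subst id (OnInt≡ l _) h)

  valid : G.Valid → G′.Valid
  valid v@(contains , _ , noCross-all) =
    (λ j → subst id (sym (ContainsPt≡ j)) (contains (φ j))) ,
    ((λ j → supported v j low) , (λ j → supported v j high)) ,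
    (λ j k j≢k → noCross j k (noCross-all (φ j) (φ k) (j≢k ∘ φ-injective)))

module _ {n} (C : Config n) where

  Valid-resp-≗ : ∀ {E E′} → E ≗ E′ → Geometry.Valid C E → Geometry.Valid C E′
  Valid-resp-≗ {E} {E′} E≗E′ = Restriction.valid C C id id (λ _ _ → refl) (λ _ → refl) E′ E
    (λ j → trans (E≗E′ j) (sym (relabel-map-id (E′ j))))
    where
    relabel-map-id : ∀ d → relabel (Maybe.map id) d ≡ d
    relabel-map-id (o , l , h) = cong₂ (λ l h → (o , l , h)) (Maybe.map-id l) (Maybe.map-id h)

  ∈-rects : ∀ {E} → Geometry.Valid C E → Membership._∈_ (encodingSetoid n) E (rects C)
  ∈-rects {E} = Membershipₚ.∈-filter⁺ (encodingSetoid n) (Geometry.valid? C) Valid-resp-≗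
    (∈-allFuns (allSegData n) n E (λ j → ∈-allSegData (E j)))

-- Deleting a point of degree two

Unstopped : ∀ {n} → Fin n → Encoding n → Set
Unstopped i E = ∀ k s → stopOf (E k) s ≢ just i

module _ {n} (C : Config n) (E : Encoding n) where
  open Geometry C E

  endpoint-onSeg : ∀ i s → ContainsPt i → OnSeg i (endpoint i s)
  endpoint-onSeg i low  (l , h) with orient i
  ... | ver = refl , ≤-refl , <⇒≤ (<-trans l h)
  ... | hor = refl , ≤-refl , <⇒≤ (<-trans l h)
  endpoint-onSeg i high (l , h) with orient i
  ... | ver = refl , <⇒≤ (<-trans l h) , ≤-refl
  ... | hor = refl , <⇒≤ (<-trans l h) , ≤-refl

  OnInt⇒OnSeg : ∀ i q → OnInt i q → OnSeg i q
  OnInt⇒OnSeg i (x , y) with orient i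
  ... | ver = λ (e , l , h) → e , <⇒≤ l , <⇒≤ h
  ... | hor = λ (e , l , h) → e , <⇒≤ l , <⇒≤ h

  ∈-endpoints : ∀ j s → (j , s) ∈ endpoints
  ∈-endpoints j s = ∈-concatMap⁺′ (setoid _) (λ j → (j , low) ∷ (j , high) ∷ []) (∈-allFin j) (∈-sides s)
    where
    ∈-sides : ∀ s → (j , s) ∈ (j , low) ∷ (j , high) ∷ []
    ∈-sides low  = here refl
    ∈-sides high = there (here refl)

  -- If segment j ended on segment i, then the two endpoints of i and that endpoint of j would be
  -- three intersections on i.
  degree≡2⇒Unstopped : Valid → ∀ i → degree i ≡ 2 → Unstopped i E
  degree≡2⇒Unstopped valid i deg≡2 j s stops-at-i = ℕ.<-irrefl refl (subst (3 ≤_) deg≡2 three≤degree)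
    where
    supported-j : Views.SupportedBy C E j (just i) (endpoint j s)
    supported-j = subst (λ k? → Views.SupportedBy C E j k? (endpoint j s)) (trans (Views.stopper≡ C E j s) stops-at-i)
                    (Views.supported C E valid j s)
    i≢j = proj₁ supported-j
    three≤degree : 3 ≤ degree i
    three≤degree = injective⇒length-≤ (setoid _) (setoid _) id
      (((λ ()) ∷ (i≢j ∘ cong proj₁) ∷ []) ∷ ((i≢j ∘ cong proj₁) ∷ []) ∷ [] ∷ [])
      (λ _ _ e → e)
      λ { (here refl)                 → ∈-filter⁺ _ (∈-endpoints i low)  (endpoint-onSeg i low (proj₁ valid i))
        ; (there (here refl))         → ∈-filter⁺ _ (∈-endpoints i high) (endpoint-onSeg i high (proj₁ valid i))
        ; (there (there (here refl))) → ∈-filter⁺ _ (∈-endpoints j s) (OnInt⇒OnSeg i _ (proj₂ supported-j)) }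

restrict : ∀ {m} → Config (suc m) → Fin (suc m) → Config m
restrict C i = record
  { xmin = xmin ; xmax = xmax ; ymin = ymin ; ymax = ymax ; xmin<xmax = xmin<xmax ; ymin<ymax = ymin<ymax
  ; px = px ∘ punchIn i ; py = py ∘ punchIn i
  ; px-inj = λ j k → punchIn-injective i j k ∘ px-inj _ _
  ; py-inj = λ j k → punchIn-injective i j k ∘ py-inj _ _
  ; inside = inside ∘ punchIn i }
  where open Config C

boxBound-restrict : ∀ {m} (C : Config (suc m)) i o s → boxBound (restrict C i) o s ≡ boxBound C o s
boxBound-restrict C i ver low  = refl
boxBound-restrict C i ver high = refl
boxBound-restrict C i hor low  = refl
boxBound-restrict C i hor high = refl

delete : ∀ {m} → Fin (suc m) → Maybe (Fin (suc m)) → Maybe (Fin m)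
delete i nothing  = nothing
delete i (just k) with i ≟ᶠ k
... | yes _   = nothing
... | no  i≢k = just (punchOut i≢k)

map-punchIn-delete : ∀ {m} (i : Fin (suc m)) k? → k? ≢ just i → Maybe.map (punchIn i) (delete i k?) ≡ k?
map-punchIn-delete i nothing  _   = refl
map-punchIn-delete i (just k) k≢i with i ≟ᶠ k
... | yes refl = contradiction refl k≢i
... | no  i≢k  = cong just (punchIn-punchOut i≢k)

relabel-punchIn-delete : ∀ {m} (i : Fin (suc m)) d → (∀ s → stopOf d s ≢ just i) →
  relabel (Maybe.map (punchIn i)) (relabel (delete i) d) ≡ d
relabel-punchIn-delete i (o , l , h) unstopped =
  cong₂ (λ l h → (o , l , h)) (map-punchIn-delete i l (unstopped low)) (map-punchIn-delete i h (unstopped high))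

remove : ∀ {m} → Fin (suc m) → Encoding (suc m) → Encoding m
remove i E j = relabel (delete i) (E (punchIn i j))

remove-injective : ∀ {m} (i : Fin (suc m)) {E E′} → Unstopped i E → Unstopped i E′ →
  remove i E ≗ remove i E′ → ∀ k → k ≢ i → E k ≡ E′ k
remove-injective i {E} {E′} unstopped unstopped′ E≗E′ k k≢i = begin
  E k                                              ≡⟨ cong E (punchIn-punchOut i≢k) ⟨
  E (punchIn i j)                                  ≡⟨ relabel-punchIn-delete i _ (unstopped (punchIn i j)) ⟨
  relabel (Maybe.map (punchIn i)) (remove i E j)   ≡⟨ cong (relabel (Maybe.map (punchIn i))) (E≗E′ j) ⟩
  relabel (Maybe.map (punchIn i)) (remove i E′ j)  ≡⟨ relabel-punchIn-delete i _ (unstopped′ (punchIn i j)) ⟩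
  E′ (punchIn i j)                                 ≡⟨ cong E′ (punchIn-punchOut i≢k) ⟩
  E′ k                                             ∎
  where
  open ≡-Reasoning
  i≢k = k≢i ∘ sym
  j = punchOut i≢k

Valid-remove : ∀ {m} (C : Config (suc m)) i {E} → Geometry.Valid C E → Unstopped i E →
  Geometry.Valid (restrict C i) (remove i E)
Valid-remove C i {E} valid unstopped =
  Restriction.valid (restrict C i) C (punchIn i) (punchIn-injective i _ _) (boxBound-restrict C i) (λ _ → refl)
    (remove i E) E (λ j → sym (relabel-punchIn-delete i (E (punchIn i j)) (unstopped (punchIn i j)))) valid

-- Recovering the deleted segment

-- If E′ stops segment i at segment k, the stopping point is the
-- crossing of the lines of i and k and lies inside segment k, also for E; so if segment i
-- reached beyond it in E, segments i and k would cross in E.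
module NoOverhang {n} (C : Config n) (E E′ : Encoding n) (valid : Geometry.Valid C E) (valid′ : Geometry.Valid C E′)
  (i : Fin n) (same-orient : Geometry.orient C E i ≡ Geometry.orient C E′ i)
  (agree : ∀ k → k ≢ i → E k ≡ E′ k) where

  private
    module G  = Geometry C E
    module G′ = Geometry C E′
    module V  = Views C E
    module V′ = Views C E′

  endC′-stopped : ∀ s {k} → G′.stopper i s ≡ just k → G′.endC i s ≡ coord (G.orient i) (point C k)
  endC′-stopped s {k} stops = trans (V′.endC-stopped i s stops) (cong (λ o → coord o (point C k)) (sym same-orient))

  ¬overhang : ∀ s k → G′.stopper i s ≡ just k → ¬ Beyond s (G.endC i s) (G′.endC i s)
  ¬overhang s k stops beyond = proj₂ (proj₂ valid) i k (k≢i ∘ sym) (onInt-i , onInt-k)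
    where
    supported′ : V′.SupportedBy i (just k) (G′.endpoint i s)
    supported′ = subst (λ k? → V′.SupportedBy i k? (G′.endpoint i s)) stops (V′.supported valid′ i s)
    k≢i = proj₁ supported′
    endpoint′≡crossPt : G′.endpoint i s ≡ G.crossPt i k
    endpoint′≡crossPt = begin
      G′.endpoint i s                                                    ≡⟨ V′.endpoint≡ i s ⟩
      withCoord (G′.orient i) (point C i) (endCoord (V′.segmentAt i) s)
        ≡⟨ cong₂ (λ o c → withCoord o (point C i) c) (sym same-orient) (trans (V′.endCoord≡ i s) (endC′-stopped s stops)) ⟩
      meet (V.segmentAt i) (point C k)                                   ≡⟨ V.crossPt≡ i k ⟨
      G.crossPt i k                                                      ∎
      where open ≡-Reasoning
    spans′ : Spans (segment (G.orient i) (point C i) (G′.endC i low) (G′.endC i high))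
    spans′ = subst (λ o → Spans (segment o (point C i) (G′.endC i low) (G′.endC i high))) (sym same-orient)
               (subst id (V′.ContainsPt≡ i) (proj₁ valid′ i))
    onInt-i : G.OnInt i (G.crossPt i k)
    onInt-i = subst (G.OnInt i) (sym (V.crossPt≡ i k)) (subst id (sym (V.OnInt≡ i _))
                (overhang⇒interior-meet (G.orient i) (point C i) (G.endC i) (G′.endC i) s (point C k)
                   (subst id (V.ContainsPt≡ i) (proj₁ valid i)) spans′ (endC′-stopped s stops) beyond))
    onInt-k : G.OnInt k (G.crossPt i k)
    onInt-k = subst (G.OnInt k) endpoint′≡crossPt
                (subst id (sym (OnInt-local C k _ (agree k k≢i))) (proj₂ supported′))

module Agreement {n} (C : Config n) (E E′ : Encoding n) (valid : Geometry.Valid C E) (valid′ : Geometry.Valid C E′)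
  (i : Fin n) (same-orient : Geometry.orient C E i ≡ Geometry.orient C E′ i)
  (agree : ∀ k → k ≢ i → E k ≡ E′ k) where

  private
    module G  = Geometry C E
    module G′ = Geometry C E′
    module V  = Views C E
    module V′ = Views C E′
    module A  = NoOverhang C E E′ valid valid′ i same-orient agree
    module A′ = NoOverhang C E′ E valid′ valid i (sym same-orient) (λ k k≢i → sym (agree k k≢i))

  stopper-agrees : ∀ s → G.stopper i s ≡ G′.stopper i s
  stopper-agrees s with G.stopper i s in stops | G′.stopper i s in stops′
  ... | nothing | nothing = refl
  ... | nothing | just k′ = ⊥-elim (A.¬overhang s k′ stops′
        (subst₂ (Beyond s) (sym (V.endC-unstopped i s stops)) (sym (A.endC′-stopped s stops′))
           (boxBound-beyond C (G.orient i) s k′)))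
  ... | just k  | nothing = ⊥-elim (A′.¬overhang s k stops
        (subst₂ (Beyond s) (sym (V′.endC-unstopped i s stops′)) (sym (A′.endC′-stopped s stops))
           (boxBound-beyond C (G′.orient i) s k)))
  ... | just k  | just k′ = cong just (coord-injective C (G.orient i)
        (trans (sym (V.endC-stopped i s stops)) (trans endC≡endC′ (A.endC′-stopped s stops′))))
    where
    endC≡endC′ : G.endC i s ≡ G′.endC i s
    endC≡endC′ = ¬Beyond⇒≡ s (A.¬overhang s k′ stops′) (A′.¬overhang s k stops)

  agrees : E ≗ E′
  agrees k with k ≟ᶠ i
  ... | yes refl = cong₂ _,_ same-orient (cong₂ _,_ (stopper-agrees low) (stopper-agrees high))
  ... | no  k≢i  = agree k k≢i

-- The double count

module _ {m} (C : Config (suc m)) (i : Fin (suc m)) where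

  degree≡2? : ∀ E → Dec (Geometry.degree C E i ≡ 2)
  degree≡2? E = Geometry.degree C E i ℕ.≟ 2

  orient-and-remove : Encoding (suc m) → Orient × Encoding m
  orient-and-remove E = (Geometry.orient C E i , remove i E)

  degree≡2-count : ∀ M → rc (restrict C i) ≤ M → length (filter degree≡2? (rects C)) ≤ 2 ℕ.* M
  degree≡2-count M rc≤M = begin
    length (filter degree≡2? (rects C))
      ≤⟨ injective⇒length-≤ Target (encodingSetoid (suc m)) orient-and-remove
           (Unique.filter⁺ (encodingSetoid (suc m)) degree≡2? (rects-unique C)) injective into ⟩
    length (cartesianProduct (hor ∷ ver ∷ []) (rects (restrict C i)))
      ≡⟨ length-cartesianProduct (hor ∷ ver ∷ []) (rects (restrict C i)) ⟩
    2 ℕ.* rc (restrict C i)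
      ≤⟨ ℕ.*-monoʳ-≤ 2 rc≤M ⟩
    2 ℕ.* M ∎
    where
    open ℕ.≤-Reasoning
    Target = setoid Orient ×ₛ encodingSetoid m
    valid : ∀ {E} → E ∈ filter degree≡2? (rects C) → Geometry.Valid C E
    valid E∈ = proj₂ (∈-filter⁻ (Geometry.valid? C) {xs = allEncodings (suc m)}
                                (proj₁ (∈-filter⁻ degree≡2? {xs = rects C} E∈)))
    unstopped : ∀ {E} → E ∈ filter degree≡2? (rects C) → Unstopped i E
    unstopped {E} E∈ = degree≡2⇒Unstopped C E (valid E∈) i (proj₂ (∈-filter⁻ degree≡2? {xs = rects C} E∈))
    injective : ∀ {E E′} → E ∈ filter degree≡2? (rects C) → E′ ∈ filter degree≡2? (rects C) →
      Setoid._≈_ Target (orient-and-remove E) (orient-and-remove E′) → E ≗ E′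
    injective {E} {E′} E∈ E′∈ (same-orient , remove≗) =
      Agreement.agrees C E E′ (valid E∈) (valid E′∈) i same-orient
        (remove-injective i (unstopped E∈) (unstopped E′∈) remove≗)
    into : ∀ {E} → E ∈ filter degree≡2? (rects C) →
      Membership._∈_ Target (orient-and-remove E) (cartesianProduct (hor ∷ ver ∷ []) (rects (restrict C i)))
    into {E} E∈ = Membershipₚ.∈-cartesianProduct⁺ (setoid Orient) (encodingSetoid m)
      (∈-orientations (Geometry.orient C E i)) (∈-rects (restrict C i) (Valid-remove C i (valid E∈) (unstopped E∈)))

degree≡2-total : ∀ {m} (C : Config (suc m)) M → ((Q : Config m) → rc Q ≤ M) →
  sum (map (λ E → Geometry.dcount C E 2) (rects C)) ≤ suc m ℕ.* (2 ℕ.* M)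
degree≡2-total {m} C M rc≤M = begin
  sum (map (λ E → Geometry.dcount C E 2) (rects C))
    ≡⟨ double-counting (λ E i → Geometry.degree C E i ℕ.≟ 2) (rects C) (allFin (suc m)) ⟩
  sum (map (λ i → length (filter (degree≡2? C i) (rects C))) (allFin (suc m)))
    ≤⟨ sum-map-≤ _ (allFin (suc m)) (λ i → degree≡2-count C i M (rc≤M (restrict C i))) ⟩
  length (allFin (suc m)) ℕ.* (2 ℕ.* M)
    ≡⟨ cong (ℕ._* (2 ℕ.* M)) (length-tabulate {n = suc m} id) ⟩
  suc m ℕ.* (2 ℕ.* M) ∎
  where open ℕ.≤-Reasoning

-- Rational arithmetic

toℚᵘ-toℚ : ∀ a → toℚᵘ (toℚ a) ℚᵘ.≃ ℚᵘ.mkℚᵘ (+ a) 0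
toℚᵘ-toℚ a = toℚᵘ-fromℚᵘ (ℚᵘ.mkℚᵘ (+ a) 0)

toℚ-mono-≤ : ∀ {a b} → a ≤ b → toℚ a ≤ℚ toℚ b
toℚ-mono-≤ {a} {b} a≤b = toℚᵘ-cancel-≤
  (ℚᵘ.≤-respˡ-≃ (ℚᵘ.≃-sym (toℚᵘ-toℚ a)) (ℚᵘ.≤-respʳ-≃ (ℚᵘ.≃-sym (toℚᵘ-toℚ b))
    (ℚᵘ.*≤* (ℤ.*-monoʳ-≤-nonNeg (+ 1) (ℤ.+≤+ a≤b)))))

toℚ-* : ∀ a b → toℚ (a ℕ.* b) ≡ toℚ a * toℚ b
toℚ-* a b = toℚᵘ-injective (ℚᵘ.≃-trans (toℚᵘ-toℚ (a ℕ.* b))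
  (ℚᵘ.≃-trans (ℚᵘ.*≡* (cong (ℤ._* + 1) (ℤ.pos-* a b)))
  (ℚᵘ.≃-sym (ℚᵘ.≃-trans (toℚᵘ-homo-* (toℚ a) (toℚ b))
                        (ℚᵘ.*-cong (toℚᵘ-toℚ a) (toℚᵘ-toℚ b))))))

/-*-cancel : ∀ s k → (+ s / suc k) * toℚ (suc k) ≡ toℚ s
/-*-cancel s k = toℚᵘ-injective (ℚᵘ.≃-trans (toℚᵘ-homo-* (+ s / suc k) (toℚ (suc k)))
  (ℚᵘ.≃-trans (ℚᵘ.*-cong (toℚᵘ-fromℚᵘ (ℚᵘ.mkℚᵘ (+ s) k)) (toℚᵘ-toℚ (suc k)))
  (ℚᵘ.≃-trans (ℚᵘ.*≡* (trans (ℤ.*-identityʳ _) (cong (λ d → + s ℤ.* + d) (sym (ℕ.*-identityʳ (suc k))))))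
  (ℚᵘ.≃-sym (toℚᵘ-toℚ s)))))

average-*-length : ∀ xs → average xs * toℚ (length xs) ≡ toℚ (sum xs)
average-*-length []       = refl
average-*-length (x ∷ xs) = /-*-cancel (sum (x ∷ xs)) (length xs)

dhat-*-rc : ∀ {n} k (P : Config n) →
  dhat k P * toℚ (rc P) ≡ toℚ (sum (map (λ E → Geometry.dcount P E k) (rects P)))
dhat-*-rc k P = trans (cong (λ r → average degrees * toℚ r) (sym (length-map _ (rects P)))) (average-*-length degrees)
  where degrees = map (λ E → Geometry.dcount P E k) (rects P)

δar≤ac⇒r≤c/δ : ∀ δ .{{_ : Positive δ}} a .{{_ : Positive a}} {r c} →
  δ * a * r ≤ℚ a * c → r ≤ℚ (1/ δ) {{pos⇒nonZero δ}} * c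
δar≤ac⇒r≤c/δ δ a {r} {c} δar≤ac = begin
  r               ≡⟨ trans (sym (*-assoc (1/ δ) δ r)) (trans (cong (_* r) (*-inverseˡ δ)) (*-identityˡ r)) ⟨
  1/ δ * (δ * r)  ≤⟨ *-monoˡ-≤-nonNeg (1/ δ) {{pos⇒nonNeg (1/ δ) {{1/pos⇒pos δ}}}} δr≤c ⟩
  1/ δ * c        ∎
  where
  open ℚ.≤-Reasoning
  instance _ = pos⇒nonZero δ
  δr≤c : δ * r ≤ℚ c
  δr≤c = *-cancelˡ-≤-pos a (subst (_≤ℚ a * c) (trans (cong (_* r) (*-comm δ a)) (*-assoc a δ r)) δar≤ac)

lemma3p1 : (n : ℕ) → 2 ≤ n → (δ : ℚ) → .{{δ>0 : Positive δ}} →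
  ((P : Config n) → δ * toℚ n ≤ℚ dhat 2 P) →
  (M : ℕ) → ((Q : Config (n ∸ 1)) → rc Q ≤ M) →
  (P : Config n) → toℚ (rc P) ≤ℚ ((+ 2 / 1) ÷ δ) {{pos⇒nonZero δ}} * toℚ M
lemma3p1 (suc m) (s≤s _) δ dhat≥δn M rc≤M P = begin
  toℚ (rc P)                  ≤⟨ δar≤ac⇒r≤c/δ δ (toℚ (suc m)) {{normalize-pos (suc m) 1}} δnr≤n2M ⟩
  1/ δ * ((+ 2 / 1) * toℚ M)  ≡⟨ *-assoc (1/ δ) (+ 2 / 1) (toℚ M) ⟨
  1/ δ * (+ 2 / 1) * toℚ M    ≡⟨ cong (_* toℚ M) (*-comm (1/ δ) (+ 2 / 1)) ⟩
  ((+ 2 / 1) ÷ δ) * toℚ M     ∎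
  where
  open ℚ.≤-Reasoning
  instance _ = pos⇒nonZero δ
  δnr≤n2M : δ * toℚ (suc m) * toℚ (rc P) ≤ℚ toℚ (suc m) * ((+ 2 / 1) * toℚ M)
  δnr≤n2M = begin
    δ * toℚ (suc m) * toℚ (rc P)                           ≤⟨ *-monoʳ-≤-nonNeg _ {{normalize-nonNeg (rc P) 1}} (dhat≥δn P) ⟩
    dhat 2 P * toℚ (rc P)                                  ≡⟨ dhat-*-rc 2 P ⟩
    toℚ (sum (map (λ E → Geometry.dcount P E 2) (rects P))) ≤⟨ toℚ-mono-≤ (degree≡2-total P M rc≤M) ⟩
    toℚ (suc m ℕ.* (2 ℕ.* M))                              ≡⟨ toℚ-* (suc m) (2 ℕ.* M) ⟩
    toℚ (suc m) * toℚ (2 ℕ.* M)                            ≡⟨ cong (toℚ (suc m) *_) (toℚ-* 2 M) ⟩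
    toℚ (suc m) * ((+ 2 / 1) * toℚ M)                      ∎
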